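{- For every integer $n\ge 2$, \[ \gamma_{2t}(K_n\Box K_{n+1})=\begin{cases}(3n+2)/2, & n\equiv 0\pmod 2,\\ (3n+3)/2, & n\equiv 1\pmod 2.\end{cases} \]
   Context: $K_n$ denotes the complete graph on $n$ vertices. The Cartesian product $G\Box H$ has vertex set $V(G)\times V(H)$, with $(u_1,v_1)\sim(u_2,v_2)$ iff either $u_1=u_2$ and $v_1\sim v_2$, or $v_1=v_2$ and $u_1\sim u_2$. A set $S$ of vertices of a graph $G$ is total $2$-dominating if every vertex of $G$ is adjacent to at least two vertices of $S$; $\gamma_{2t}(G)$ is the minimum cardinality of such a set. -}

module Defs where

open import Level using (0ℓ)
open import Data.Nat using (ℕ; suc; _≤_)
open import Data.Fin using (Fin)
open import Data.Product using (_×_; _,_; Σ; ∃-syntax)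
open import Data.List using (List; length)
open import Data.List.Membership.Propositional using (_∈_)
open import Data.List.Relation.Unary.Unique.Propositional using (Unique)
open import Relation.Binary.PropositionalEquality using (_≡_; _≢_)
open import Relation.Nullary using (¬_)
open import Data.Sum using (_⊎_)

record Graph : Set₁ where
  field
    V   : Set
    Adj : V → V → Set
open Graph public

K : ℕ → Graph
K n = record { V = Fin n ; Adj = λ u v → u ≢ v }

_□_ : Graph → Graph → Graph
G □ H = record
  { V   = V G × V H
  ; Adj = λ { (u₁ , v₁) (u₂ , v₂) →
              (u₁ ≡ u₂ × Adj H v₁ v₂) ⊎ (v₁ ≡ v₂ × Adj G u₁ u₂) } }

-- a vertex set is a duplicate-free list; its cardinality is its length
-- S is total 2-dominating: every vertex has two distinct neighbours in S
IsTotal2Dom : (G : Graph) → List (V G) → Set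
IsTotal2Dom G S = ∀ (x : V G) →
  ∃[ a ] ∃[ b ] (a ∈ S × b ∈ S × a ≢ b × Adj G x a × Adj G x b)

γ2t≡ : Graph → ℕ → Set
γ2t≡ G k =
  (∃[ S ] (Unique S × IsTotal2Dom G S × length S ≡ k)) ×
  (∀ (S : List (V G)) → Unique S → IsTotal2Dom G S → k ≤ length S)

module Submission where

-- Let S be total 2-dominating in Kₙ □ Kₙ₊₁, with rᵢ elements in row i and cⱼ in
-- column j. Cell (i , j) has two neighbours in S on its row and column, and a cell of
-- S also counts itself twice, so rᵢ + cⱼ ≥ 2, and ≥ 4 when (i , j) ∈ S. If a row
-- (column) misses S, every column (row) holds two elements, so |S| ≥ 2n. Otherwise let
-- X (Y) count the elements of S alone in their row (column); no element is both. Giving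
-- each row 3rᵢ + 3[rᵢ = 1] ≥ 6 + #{x in row i alone in its column} (such x need rᵢ ≥ 3)
-- yields 6n + Y ≤ 3|S| + 3X, symmetrically 6(n + 1) + X ≤ 3|S| + 3Y, and adding,
-- 4|S| ≥ 6n + 3. Conversely, explicit sets for n ≤ 6 and a step n ↦ n + 4 that adds six
-- cells in a new 4 × 4 corner give 4|S| ≤ 6n + 6; the two bounds fix |S|.

open import Defs
open import Data.Nat using (ℕ; zero; suc; _+_; _*_; _≤_; _/_; _%_; _≤?_; z≤n; s≤s)
open import Data.Nat.Properties
open import Data.Nat.DivMod using (m≡m%n+[m/n]*n; m*n/n≡m)
open import Data.Nat.Tactic.RingSolver using (solve-∀)
open import Data.Fin using (Fin; zero; suc; #_) renaming (_≟_ to _≟ᶠ_)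
open import Data.Fin.Properties using (all?; ¬∀⟶∃¬)
open import Data.Product using (_×_; _,_; ∃-syntax; proj₁; proj₂)
open import Data.Product.Properties using (≡-dec)
open import Data.Sum using (inj₁; inj₂)
open import Data.List using (List; []; _∷_; length; map; _++_)
open import Data.List.Properties using (length-map)
open import Data.List.Membership.Propositional using (_∈_; _∉_; find; lose)
open import Data.List.Membership.Propositional.Properties using (∈-map⁺; ∈-map⁻; ∈-++⁺ʳ)
open import Data.List.Relation.Unary.Any using (Any; here; there) renaming (any? to anyₗ?)
open import Data.List.Relation.Unary.AllPairs using (allPairs?)
open import Data.List.Relation.Unary.Unique.Propositional using (Unique)
import Data.List.Relation.Unary.Unique.Propositional.Properties as Unique
open import Data.Empty using (⊥-elim)
open import Function using (_∘_)
open import Relation.Binary using (DecidableEquality)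
open import Relation.Binary.PropositionalEquality
open import Relation.Nullary using (Dec; yes; no; ¬?)
open import Relation.Nullary.Decidable using (_×-dec_; _⊎-dec_; toWitness; True)

Rook : ℕ → Graph
Rook n = K n □ K (suc n)

Cell : ℕ → Set
Cell n = V (Rook n)

quarter-cancel : ∀ {a b} → 4 * a ≤ 4 * b + 3 → a ≤ b
quarter-cancel {a} {b} h = m<1+n⇒m≤n (*-cancelˡ-< 4 a (suc b) (≤-trans (s≤s h) (≤-reflexive (eq b))))
  where
  eq : ∀ b → suc (4 * b + 3) ≡ 4 * suc b
  eq = solve-∀

γ2t≡-from-quarter-bounds : (G : Graph) (c C k : ℕ) → c ≤ 4 * k → 4 * k ≤ C → C ≤ c + 3 →
  (∃[ S ] (Unique S × IsTotal2Dom G S × 4 * length S ≤ C)) →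
  (∀ S → Unique S → IsTotal2Dom G S → c ≤ 4 * length S) →
  γ2t≡ G k
γ2t≡-from-quarter-bounds G c C k c≤4k 4k≤C C≤c+3 (S , unique , dom , 4|S|≤C) lower =
  (S , unique , dom , ≤-antisym (below c≤4k 4|S|≤C) (below (lower S unique dom) 4k≤C)) ,
  λ T unique′ dom′ → below (lower T unique′ dom′) 4k≤C
  where
  below : ∀ {x y} → c ≤ 4 * x → 4 * y ≤ C → y ≤ x
  below c≤4x 4y≤C = quarter-cancel (≤-trans 4y≤C (≤-trans C≤c+3 (+-monoˡ-≤ 3 c≤4x)))

∑ : (a : ℕ) → (Fin a → ℕ) → ℕ
∑ zero    f = 0
∑ (suc a) f = f zero + ∑ a (f ∘ suc)

δ : ∀ {a} → Fin a → Fin a → ℕ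
δ zero    zero    = 1
δ zero    (suc _) = 0
δ (suc _) zero    = 0
δ (suc i) (suc j) = δ i j

δ-refl : ∀ {a} (i : Fin a) → δ i i ≡ 1
δ-refl zero    = refl
δ-refl (suc i) = δ-refl i

∑-cong : ∀ a {f g : Fin a → ℕ} → (∀ i → f i ≡ g i) → ∑ a f ≡ ∑ a g
∑-cong zero    f≡g = refl
∑-cong (suc a) f≡g = cong₂ _+_ (f≡g zero) (∑-cong a (f≡g ∘ suc))

∑-mono : ∀ a {f g : Fin a → ℕ} → (∀ i → f i ≤ g i) → ∑ a f ≤ ∑ a g
∑-mono zero    f≤g = z≤n
∑-mono (suc a) f≤g = +-mono-≤ (f≤g zero) (∑-mono a (f≤g ∘ suc))

∑-+ : ∀ a (f g : Fin a → ℕ) → ∑ a (λ i → f i + g i) ≡ ∑ a f + ∑ a g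
∑-+ zero    f g = refl
∑-+ (suc a) f g = begin
  f zero + g zero + ∑ a (λ i → f (suc i) + g (suc i))
    ≡⟨ cong (f zero + g zero +_) (∑-+ a (f ∘ suc) (g ∘ suc)) ⟩
  f zero + g zero + (∑ a (f ∘ suc) + ∑ a (g ∘ suc))
    ≡⟨ +-+-comm (f zero) (g zero) _ _ ⟩
  f zero + ∑ a (f ∘ suc) + (g zero + ∑ a (g ∘ suc)) ∎
  where
  open ≡-Reasoning
  +-+-comm : ∀ w x y z → w + x + (y + z) ≡ w + y + (x + z)
  +-+-comm = solve-∀

∑-const : ∀ a c → ∑ a (λ _ → c) ≡ a * c
∑-const zero    c = refl
∑-const (suc a) c = cong (c +_) (∑-const a c)

∑-*0 : ∀ a (g : Fin a → ℕ) → ∑ a (λ i → g i * 0) ≡ 0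
∑-*0 a g = trans (∑-cong a (λ i → *-zeroʳ (g i))) (trans (∑-const a 0) (*-zeroʳ a))

∑-δ : ∀ a (g : Fin a → ℕ) (k : Fin a) → ∑ a (λ i → g i * δ k i) ≡ g k
∑-δ (suc a) g zero    = trans (cong₂ _+_ (*-identityʳ (g zero)) (∑-*0 a (g ∘ suc))) (+-identityʳ (g zero))
∑-δ (suc a) g (suc k) = trans (cong (_+ ∑ a (λ i → g (suc i) * δ k i)) (*-zeroʳ (g zero))) (∑-δ a (g ∘ suc) k)

module _ {A : Set} where

  sumBy : (A → ℕ) → List A → ℕ
  sumBy f []       = 0
  sumBy f (x ∷ xs) = f x + sumBy f xs

  sumBy-+ : ∀ (f g : A → ℕ) xs → sumBy (λ x → f x + g x) xs ≡ sumBy f xs + sumBy g xs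
  sumBy-+ f g []       = refl
  sumBy-+ f g (x ∷ xs) rewrite sumBy-+ f g xs = +-+-comm (f x) (g x) (sumBy f xs) (sumBy g xs)
    where
    +-+-comm : ∀ w x y z → w + x + (y + z) ≡ w + y + (x + z)
    +-+-comm = solve-∀

  sumBy-affine : ∀ b c (f : A → ℕ) xs → sumBy (λ x → b + c * f x) xs ≡ b * length xs + c * sumBy f xs
  sumBy-affine b c f []       = sym (cong₂ _+_ (*-zeroʳ b) (*-zeroʳ c))
  sumBy-affine b c f (x ∷ xs) rewrite sumBy-affine b c f xs = regroup b c (f x) (length xs) (sumBy f xs)
    where
    regroup : ∀ b c y l s → b + c * y + (b * l + c * s) ≡ b * suc l + c * (y + s)
    regroup = solve-∀

  sumBy-length : ∀ (xs : List A) → sumBy (λ _ → 1) xs ≡ length xs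
  sumBy-length []       = refl
  sumBy-length (x ∷ xs) = cong suc (sumBy-length xs)

  sumBy-mono : ∀ {f g : A → ℕ} xs → (∀ x → x ∈ xs → f x ≤ g x) → sumBy f xs ≤ sumBy g xs
  sumBy-mono []       f≤g = z≤n
  sumBy-mono (x ∷ xs) f≤g = +-mono-≤ (f≤g x (here refl)) (sumBy-mono xs (λ y y∈ → f≤g y (there y∈)))

  sumBy-remove : ∀ (f : A → ℕ) {xs x} → x ∈ xs →
    ∃[ ys ] (sumBy f xs ≡ f x + sumBy f ys × (∀ y → y ∈ xs → y ≢ x → y ∈ ys))
  sumBy-remove f {y ∷ xs} (here refl) = xs , refl , λ
    { z (here z≡y) z≢y → ⊥-elim (z≢y z≡y)
    ; z (there z∈) z≢y → z∈ }
  sumBy-remove f {y ∷ xs} {x} (there x∈) with sumBy-remove f x∈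
  ... | ys , sum≡ , keeps = y ∷ ys , trans (cong (f y +_) sum≡) (+-left-comm (f y) (f x) _) , λ
    { z (here z≡y) z≢x → here z≡y
    ; z (there z∈) z≢x → there (keeps z z∈ z≢x) }
    where
    +-left-comm : ∀ a b c → a + (b + c) ≡ b + (a + c)
    +-left-comm = solve-∀

  member≤sumBy : ∀ (f : A → ℕ) {xs x} → x ∈ xs → f x ≤ sumBy f xs
  member≤sumBy f x∈ with sumBy-remove f x∈
  ... | _ , sum≡ , _ = ≤-trans (m≤m+n _ _) (≤-reflexive (sym sum≡))

  pair≤sumBy : ∀ (f : A → ℕ) {xs x y} → x ∈ xs → y ∈ xs → x ≢ y → f x + f y ≤ sumBy f xs
  pair≤sumBy f x∈ y∈ x≢y with sumBy-remove f x∈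
  ... | _ , sum≡ , keeps =
    ≤-trans (+-monoʳ-≤ _ (member≤sumBy f (keeps _ y∈ (x≢y ∘ sym)))) (≤-reflexive (sym sum≡))

  triple≤sumBy : ∀ (f : A → ℕ) {xs x y z} → x ∈ xs → y ∈ xs → z ∈ xs →
    y ≢ z → y ≢ x → z ≢ x → f x + (f y + f z) ≤ sumBy f xs
  triple≤sumBy f x∈ y∈ z∈ y≢z y≢x z≢x with sumBy-remove f x∈
  ... | _ , sum≡ , keeps =
    ≤-trans (+-monoʳ-≤ _ (pair≤sumBy f (keeps _ y∈ y≢x) (keeps _ z∈ z≢x) y≢z)) (≤-reflexive (sym sum≡))

count : ∀ {A : Set} {a} → (A → Fin a) → Fin a → List A → ℕ
count line i = sumBy (λ x → δ (line x) i)

∑-weighted-count : ∀ {A : Set} a (line : A → Fin a) (g : Fin a → ℕ) xs →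
  ∑ a (λ i → g i * count line i xs) ≡ sumBy (g ∘ line) xs
∑-weighted-count a line g []       = ∑-*0 a g
∑-weighted-count a line g (x ∷ xs) = begin
  ∑ a (λ i → g i * (δ (line x) i + count line i xs))
    ≡⟨ ∑-cong a (λ i → *-distribˡ-+ (g i) _ _) ⟩
  ∑ a (λ i → g i * δ (line x) i + g i * count line i xs)
    ≡⟨ ∑-+ a _ _ ⟩
  ∑ a (λ i → g i * δ (line x) i) + ∑ a (λ i → g i * count line i xs)
    ≡⟨ cong₂ _+_ (∑-δ a g (line x)) (∑-weighted-count a line g xs) ⟩
  g (line x) + sumBy (g ∘ line) xs ∎
  where open ≡-Reasoning

∑-count : ∀ {A : Set} a (line : A → Fin a) xs → ∑ a (λ i → count line i xs) ≡ length xs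
∑-count a line xs = begin
  ∑ a (λ i → count line i xs)      ≡⟨ ∑-cong a (λ i → sym (*-identityˡ _)) ⟩
  ∑ a (λ i → 1 * count line i xs)  ≡⟨ ∑-weighted-count a line (λ _ → 1) xs ⟩
  sumBy (λ _ → 1) xs               ≡⟨ sumBy-length xs ⟩
  length xs                        ∎
  where open ≡-Reasoning

-- The lower bound

isOne : ℕ → ℕ
isOne 1 = 1
isOne _ = 0

atLeast3 : ℕ → ℕ
atLeast3 (suc (suc (suc _))) = 1
atLeast3 _                   = 0

isOne≤atLeast3 : ∀ r k → 4 ≤ r + k → isOne k ≤ atLeast3 r
isOne≤atLeast3 r                   0                   _ = z≤n
isOne≤atLeast3 r                   (suc (suc k))       _ = z≤n
isOne≤atLeast3 (suc (suc (suc r))) 1                   _ = ≤-refl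
isOne≤atLeast3 0                   1 (s≤s ())
isOne≤atLeast3 1                   1 (s≤s (s≤s ()))
isOne≤atLeast3 2                   1 (s≤s (s≤s (s≤s ())))

isOne+atLeast3≤1 : ∀ r → isOne r + atLeast3 r ≤ 1
isOne+atLeast3≤1 0                   = z≤n
isOne+atLeast3≤1 1                   = ≤-refl
isOne+atLeast3≤1 2                   = z≤n
isOne+atLeast3≤1 (suc (suc (suc r))) = ≤-refl

isOne+isOne≤1 : ∀ r k → 4 ≤ r + k → isOne r + isOne k ≤ 1
isOne+isOne≤1 r k h = ≤-trans (+-monoʳ-≤ (isOne r) (isOne≤atLeast3 r k h)) (isOne+atLeast3≤1 r)

line-weight : ∀ r → 1 ≤ r → 6 + atLeast3 r * r ≤ (3 + 3 * isOne r) * r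
line-weight 1                   _ = ≤-refl
line-weight 2                   _ = ≤-refl
line-weight (suc (suc (suc m))) _ = ≤-trans (m≤m+n _ (m + m)) (≤-reflexive (sym (expand m)))
  where
  expand : ∀ m → 3 * (3 + m) ≡ 6 + 1 * (3 + m) + (m + m)
  expand = solve-∀

module LineCount {A : Set} (xs : List A) {a : ℕ} (line : A → Fin a) (cross : A → ℕ) where

  size : Fin a → ℕ
  size i = count line i xs

  line-inequality : (∀ x → x ∈ xs → 4 ≤ size (line x) + cross x) → (∀ i → 1 ≤ size i) →
    a * 6 + sumBy (isOne ∘ cross) xs ≤ 3 * length xs + 3 * sumBy (isOne ∘ size ∘ line) xs
  line-inequality crowded nonempty = begin
    a * 6 + sumBy (isOne ∘ cross) xs
      ≤⟨ +-monoʳ-≤ (a * 6) (sumBy-mono xs (λ x x∈ → isOne≤atLeast3 _ _ (crowded x x∈))) ⟩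
    a * 6 + sumBy (atLeast3 ∘ size ∘ line) xs
      ≡⟨ cong₂ _+_ (∑-const a 6) (∑-weighted-count a line (atLeast3 ∘ size) xs) ⟨
    ∑ a (λ _ → 6) + ∑ a (λ i → atLeast3 (size i) * size i)
      ≡⟨ ∑-+ a _ _ ⟨
    ∑ a (λ i → 6 + atLeast3 (size i) * size i)
      ≤⟨ ∑-mono a (λ i → line-weight (size i) (nonempty i)) ⟩
    ∑ a (λ i → (3 + 3 * isOne (size i)) * size i)
      ≡⟨ ∑-weighted-count a line (λ i → 3 + 3 * isOne (size i)) xs ⟩
    sumBy (λ x → 3 + 3 * isOne (size (line x))) xs
      ≡⟨ sumBy-affine 3 3 (isOne ∘ size ∘ line) xs ⟩
    3 * length xs + 3 * sumBy (isOne ∘ size ∘ line) xs ∎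
    where open ≤-Reasoning

lines-of-size≥2 : ∀ {A : Set} a (line : A → Fin a) xs → (∀ i → 2 ≤ count line i xs) → a * 2 ≤ length xs
lines-of-size≥2 a line xs big = begin
  a * 2                        ≡⟨ ∑-const a 2 ⟨
  ∑ a (λ _ → 2)                ≤⟨ ∑-mono a big ⟩
  ∑ a (λ i → count line i xs)  ≡⟨ ∑-count a line xs ⟩
  length xs                    ∎
  where open ≤-Reasoning

counting-arith : ∀ n L X Y → n * 6 + Y ≤ 3 * L + 3 * X → suc n * 6 + X ≤ 3 * L + 3 * Y → X + Y ≤ L →
  6 * n + 3 ≤ 4 * L
counting-arith n L X Y rows cols X+Y≤L = *-cancelˡ-≤ 2 (+-cancelʳ-≤ (X + Y) _ _ (begin
  2 * (6 * n + 3) + (X + Y)              ≡⟨ lhs n X Y ⟩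
  (n * 6 + Y) + (suc n * 6 + X)          ≤⟨ +-mono-≤ rows cols ⟩
  (3 * L + 3 * X) + (3 * L + 3 * Y)      ≡⟨ rhs L X Y ⟩
  6 * L + 2 * (X + Y) + (X + Y)          ≤⟨ +-monoˡ-≤ (X + Y) (+-monoʳ-≤ (6 * L) (*-monoʳ-≤ 2 X+Y≤L)) ⟩
  6 * L + 2 * L + (X + Y)                ≡⟨ cong (_+ (X + Y)) (eight L) ⟩
  2 * (4 * L) + (X + Y)                  ∎))
  where
  open ≤-Reasoning
  lhs : ∀ n X Y → 2 * (6 * n + 3) + (X + Y) ≡ (n * 6 + Y) + (suc n * 6 + X)
  lhs = solve-∀
  rhs : ∀ L X Y → (3 * L + 3 * X) + (3 * L + 3 * Y) ≡ 6 * L + 2 * (X + Y) + (X + Y)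
  rhs = solve-∀
  eight : ∀ L → 6 * L + 2 * L ≡ 2 * (4 * L)
  eight = solve-∀

sparse-lines-arith : ∀ n L → 2 ≤ n → n * 2 ≤ L → 6 * n + 3 ≤ 4 * L
sparse-lines-arith 1             L (s≤s ()) _
sparse-lines-arith (suc (suc m)) L _        2n≤L = begin
  6 * (2 + m) + 3                    ≤⟨ m≤m+n _ (2 * m + 1) ⟩
  (6 * (2 + m) + 3) + (2 * m + 1)    ≡⟨ expand m ⟩
  4 * ((2 + m) * 2)                  ≤⟨ *-monoʳ-≤ 4 2n≤L ⟩
  4 * L                              ∎
  where
  open ≤-Reasoning
  expand : ∀ m → (6 * (2 + m) + 3) + (2 * m + 1) ≡ 4 * ((2 + m) * 2)
  expand = solve-∀

module RookLowerBound (n : ℕ) (S : List (Cell n)) (dom : IsTotal2Dom (Rook n) S) where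

  r : Fin n → ℕ
  r i = count proj₁ i S

  c : Fin (suc n) → ℕ
  c j = count proj₂ j S

  through : Fin n → Fin (suc n) → Cell n → ℕ
  through i j v = δ (proj₁ v) i + δ (proj₂ v) j

  sumBy-through : ∀ i j → sumBy (through i j) S ≡ r i + c j
  sumBy-through i j = sumBy-+ (λ v → δ (proj₁ v) i) (λ v → δ (proj₂ v) j) S

  adjacent-through : ∀ {i j v} → Adj (Rook n) (i , j) v → 1 ≤ through i j v
  adjacent-through {i} {j} {_ , j′} (inj₁ (refl , _)) rewrite δ-refl i = s≤s z≤n
  adjacent-through {i} {j} {i′ , _} (inj₂ (refl , _)) rewrite δ-refl j = m≤n+m 1 (δ i′ i)

  adjacent-≢ : ∀ {x v} → Adj (Rook n) x v → v ≢ x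
  adjacent-≢ (inj₁ (_ , j≢j)) refl = j≢j refl
  adjacent-≢ (inj₂ (_ , i≢i)) refl = i≢i refl

  cross≥2 : ∀ i j → 2 ≤ r i + c j
  cross≥2 i j with dom (i , j)
  ... | a , b , a∈ , b∈ , a≢b , adj-a , adj-b = begin
    2                                  ≤⟨ +-mono-≤ (adjacent-through adj-a) (adjacent-through adj-b) ⟩
    through i j a + through i j b      ≤⟨ pair≤sumBy (through i j) a∈ b∈ a≢b ⟩
    sumBy (through i j) S              ≡⟨ sumBy-through i j ⟩
    r i + c j                          ∎
    where open ≤-Reasoning

  cross≥4 : ∀ v → v ∈ S → 4 ≤ r (proj₁ v) + c (proj₂ v)
  cross≥4 (i , j) v∈ with dom (i , j)
  ... | a , b , a∈ , b∈ , a≢b , adj-a , adj-b = begin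
    4
      ≡⟨ cong (_+ 2) (cong₂ _+_ (δ-refl i) (δ-refl j)) ⟨
    through i j (i , j) + 2
      ≤⟨ +-monoʳ-≤ _ (+-mono-≤ (adjacent-through adj-a) (adjacent-through adj-b)) ⟩
    through i j (i , j) + (through i j a + through i j b)
      ≤⟨ triple≤sumBy (through i j) v∈ a∈ b∈ a≢b (adjacent-≢ adj-a) (adjacent-≢ adj-b) ⟩
    sumBy (through i j) S
      ≡⟨ sumBy-through i j ⟩
    r i + c j ∎
    where open ≤-Reasoning

  empty-row⇒ : ∀ i → r i ≡ 0 → suc n * 2 ≤ length S
  empty-row⇒ i rᵢ≡0 = lines-of-size≥2 (suc n) proj₂ S
    (λ j → ≤-trans (cross≥2 i j) (≤-reflexive (cong (_+ c j) rᵢ≡0)))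

  empty-col⇒ : ∀ j → c j ≡ 0 → n * 2 ≤ length S
  empty-col⇒ j cⱼ≡0 = lines-of-size≥2 n proj₁ S
    (λ i → ≤-trans (cross≥2 i j) (≤-reflexive (trans (cong (r i +_) cⱼ≡0) (+-identityʳ (r i)))))

  all-lines-met⇒ : (∀ i → 1 ≤ r i) → (∀ j → 1 ≤ c j) → 6 * n + 3 ≤ 4 * length S
  all-lines-met⇒ rows cols = counting-arith n (length S) X Y
    (LineCount.line-inequality S proj₁ (c ∘ proj₂) cross≥4 rows)
    (LineCount.line-inequality S proj₂ (r ∘ proj₁) cross≥4′ cols)
    (begin
      X + Y                                                     ≡⟨ sumBy-+ (isOne ∘ r ∘ proj₁) (isOne ∘ c ∘ proj₂) S ⟨
      sumBy (λ v → isOne (r (proj₁ v)) + isOne (c (proj₂ v))) S ≤⟨ sumBy-mono S not-both ⟩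
      sumBy (λ _ → 1) S                                         ≡⟨ sumBy-length S ⟩
      length S                                                  ∎)
    where
    open ≤-Reasoning
    X Y : ℕ
    X = sumBy (isOne ∘ r ∘ proj₁) S
    Y = sumBy (isOne ∘ c ∘ proj₂) S
    cross≥4′ : ∀ v → v ∈ S → 4 ≤ c (proj₂ v) + r (proj₁ v)
    cross≥4′ v v∈ = subst (4 ≤_) (+-comm (r (proj₁ v)) (c (proj₂ v))) (cross≥4 v v∈)
    not-both : ∀ v → v ∈ S → isOne (r (proj₁ v)) + isOne (c (proj₂ v)) ≤ 1
    not-both v v∈ = isOne+isOne≤1 (r (proj₁ v)) (c (proj₂ v)) (cross≥4 v v∈)

  lower-bound : 2 ≤ n → 6 * n + 3 ≤ 4 * length S
  lower-bound 2≤n with all? (λ i → 1 ≤? r i) | all? (λ j → 1 ≤? c j)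
  ... | no some-row-empty | _ with ¬∀⟶∃¬ n _ (λ i → 1 ≤? r i) some-row-empty
  ...   | i , rᵢ≱1 = sparse-lines-arith n (length S) 2≤n
                        (≤-trans (*-monoˡ-≤ 2 (n≤1+n n)) (empty-row⇒ i (n<1⇒n≡0 (≰⇒> rᵢ≱1))))
  lower-bound 2≤n | yes rows | no some-col-empty with ¬∀⟶∃¬ (suc n) _ (λ j → 1 ≤? c j) some-col-empty
  ...   | j , cⱼ≱1 = sparse-lines-arith n (length S) 2≤n (empty-col⇒ j (n<1⇒n≡0 (≰⇒> cⱼ≱1)))
  lower-bound 2≤n | yes rows | yes cols = all-lines-met⇒ rows cols

-- The upper bound

_≟ᶜ_ : ∀ {n} → DecidableEquality (Cell n)
_≟ᶜ_ = ≡-dec _≟ᶠ_ _≟ᶠ_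

adjacent? : ∀ {n} (x y : Cell n) → Dec (Adj (Rook n) x y)
adjacent? (i , j) (i′ , j′) = ((i ≟ᶠ i′) ×-dec ¬? (j ≟ᶠ j′)) ⊎-dec ((j ≟ᶠ j′) ×-dec ¬? (i ≟ᶠ i′))

DominatedBy : ∀ {n} → List (Cell n) → Cell n → Set
DominatedBy {n} S x = Any (λ a → Any (λ b → a ≢ b × Adj (Rook n) x a × Adj (Rook n) x b) S) S

dominatedBy? : ∀ {n} (S : List (Cell n)) x → Dec (DominatedBy S x)
dominatedBy? S x = anyₗ? (λ a → anyₗ? (λ b → ¬? (a ≟ᶜ b) ×-dec (adjacent? x a ×-dec adjacent? x b)) S) S

totallyDominatedBy? : ∀ {n} (S : List (Cell n)) → Dec (∀ i j → DominatedBy S (i , j))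
totallyDominatedBy? S = all? (λ i → all? (λ j → dominatedBy? S (i , j)))

totallyDominated⇒IsTotal2Dom : ∀ {n} (S : List (Cell n)) → (∀ i j → DominatedBy S (i , j)) → IsTotal2Dom (Rook n) S
totallyDominated⇒IsTotal2Dom S dominated (i , j) with find (dominated i j)
... | a , a∈ , b-witness with find b-witness
... | b , b∈ , a≢b , adj-a , adj-b = a , b , a∈ , b∈ , a≢b , adj-a , adj-b

MeetsRows : ∀ {n} → List (Cell n) → Set
MeetsRows S = ∀ i → Any (λ v → proj₁ v ≡ i) S

MeetsCols : ∀ {n} → List (Cell n) → Set
MeetsCols S = ∀ j → Any (λ v → proj₂ v ≡ j) S

unique? : ∀ {n} (S : List (Cell n)) → Dec (Unique S)
unique? = allPairs? (λ x y → ¬? (x ≟ᶜ y))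

meetsRows? : ∀ {n} (S : List (Cell n)) → Dec (MeetsRows S)
meetsRows? S = all? (λ i → anyₗ? (λ v → proj₁ v ≟ᶠ i) S)

meetsCols? : ∀ {n} (S : List (Cell n)) → Dec (MeetsCols S)
meetsCols? S = all? (λ j → anyₗ? (λ v → proj₂ v ≟ᶠ j) S)

record Extendable (n : ℕ) : Set where
  field
    set        : List (Cell n)
    unique     : Unique set
    dominating : IsTotal2Dom (Rook n) set
    meetsRows  : MeetsRows set
    meetsCols  : MeetsCols set
    small      : 4 * length set ≤ 6 * n + 6

certify : ∀ n (S : List (Cell n)) →
  {True (unique? S)} → {True (totallyDominatedBy? S)} → {True (meetsRows? S)} → {True (meetsCols? S)} →
  {True (4 * length S ≤? 6 * n + 6)} → Extendable n
certify n S {u} {d} {r} {c} {l} = record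
  { set        = S
  ; unique     = toWitness u
  ; dominating = totallyDominated⇒IsTotal2Dom S (toWitness d)
  ; meetsRows  = toWitness r
  ; meetsCols  = toWitness c
  ; small      = toWitness l
  }

extendable₃ : Extendable 3
extendable₃ = certify 3
  ((# 0 , # 0) ∷ (# 0 , # 1) ∷ (# 0 , # 2) ∷ (# 0 , # 3) ∷ (# 1 , # 0) ∷ (# 2 , # 0) ∷ [])

extendable₄ : Extendable 4
extendable₄ = certify 4
  ((# 0 , # 0) ∷ (# 0 , # 1) ∷ (# 0 , # 2) ∷ (# 0 , # 3) ∷ (# 1 , # 4) ∷ (# 2 , # 4) ∷ (# 3 , # 4) ∷ [])

extendable₅ : Extendable 5
extendable₅ = certify 5
  ((# 0 , # 0) ∷ (# 0 , # 1) ∷ (# 0 , # 2) ∷ (# 0 , # 3) ∷ (# 0 , # 4) ∷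
   (# 1 , # 5) ∷ (# 2 , # 5) ∷ (# 3 , # 5) ∷ (# 4 , # 5) ∷ [])

extendable₆ : Extendable 6
extendable₆ = certify 6
  ((# 0 , # 0) ∷ (# 0 , # 1) ∷ (# 0 , # 2) ∷ (# 1 , # 3) ∷ (# 1 , # 4) ∷ (# 1 , # 5) ∷
   (# 2 , # 6) ∷ (# 3 , # 6) ∷ (# 4 , # 6) ∷ (# 5 , # 6) ∷ [])

pattern 0F = zero
pattern 1F = suc zero
pattern 2F = suc (suc zero)
pattern 3F = suc (suc (suc zero))
pattern ↑⁴ i = suc (suc (suc (suc i)))

-- The old grid sits at offset 4; rows and columns 0–3 are new.
module Extension {n : ℕ} (E : Extendable n) where
  open Extendable E renaming (set to S)

  lift : Cell n → Cell (4 + n)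
  lift (i , j) = ↑⁴ i , ↑⁴ j

  lift-injective : ∀ {x y} → lift x ≡ lift y → x ≡ y
  lift-injective {i , j} {i′ , j′} refl = refl

  lift-adjacent : ∀ {x y} → Adj (Rook n) x y → Adj (Rook (4 + n)) (lift x) (lift y)
  lift-adjacent (inj₁ (refl , j≢j′)) = inj₁ (refl , λ { refl → j≢j′ refl })
  lift-adjacent (inj₂ (refl , i≢i′)) = inj₂ (refl , λ { refl → i≢i′ refl })

  corner : List (Cell (4 + n))
  corner = (0F , 0F) ∷ (0F , 1F) ∷ (0F , 2F) ∷ (1F , 3F) ∷ (2F , 3F) ∷ (3F , 3F) ∷ []

  S′ : List (Cell (4 + n))
  S′ = corner ++ map lift S

  lift∈ : ∀ {v} → v ∈ S → lift v ∈ S′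
  lift∈ v∈ = ∈-++⁺ʳ corner (∈-map⁺ lift v∈)

  00∈ : (0F , 0F) ∈ S′
  00∈ = here refl
  01∈ : (0F , 1F) ∈ S′
  01∈ = there (here refl)
  02∈ : (0F , 2F) ∈ S′
  02∈ = there (there (here refl))
  13∈ : (1F , 3F) ∈ S′
  13∈ = there (there (there (here refl)))
  23∈ : (2F , 3F) ∈ S′
  23∈ = there (there (there (there (here refl))))
  33∈ : (3F , 3F) ∈ S′
  33∈ = there (there (there (there (there (here refl)))))

  row-mate : Fin n → Fin (suc n)
  row-mate i = proj₂ (proj₁ (find (meetsRows i)))

  row-mate∈ : ∀ i → (↑⁴ i , ↑⁴ (row-mate i)) ∈ S′
  row-mate∈ i with find (meetsRows i)
  ... | _ , v∈ , refl = lift∈ v∈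

  col-mate : Fin (suc n) → Fin n
  col-mate j = proj₁ (proj₁ (find (meetsCols j)))

  col-mate∈ : ∀ j → (↑⁴ (col-mate j) , ↑⁴ j) ∈ S′
  col-mate∈ j with find (meetsCols j)
  ... | _ , v∈ , refl = lift∈ v∈

  dominating′ : IsTotal2Dom (Rook (4 + n)) S′
  dominating′ (↑⁴ i , ↑⁴ j) with dominating (i , j)
  ... | a , b , a∈ , b∈ , a≢b , adj-a , adj-b =
    lift a , lift b , lift∈ a∈ , lift∈ b∈ , a≢b ∘ lift-injective , lift-adjacent adj-a , lift-adjacent adj-b
  dominating′ (↑⁴ i , 3F) = _ , _ , 13∈ , 23∈ , (λ ()) , inj₂ (refl , λ ()) , inj₂ (refl , λ ())
  dominating′ (↑⁴ i , 0F) = _ , _ , 00∈ , row-mate∈ i , (λ ()) , inj₂ (refl , λ ()) , inj₁ (refl , λ ())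
  dominating′ (↑⁴ i , 1F) = _ , _ , 01∈ , row-mate∈ i , (λ ()) , inj₂ (refl , λ ()) , inj₁ (refl , λ ())
  dominating′ (↑⁴ i , 2F) = _ , _ , 02∈ , row-mate∈ i , (λ ()) , inj₂ (refl , λ ()) , inj₁ (refl , λ ())
  dominating′ (0F , ↑⁴ j) = _ , _ , 00∈ , 01∈ , (λ ()) , inj₁ (refl , λ ()) , inj₁ (refl , λ ())
  dominating′ (1F , ↑⁴ j) = _ , _ , 13∈ , col-mate∈ j , (λ ()) , inj₁ (refl , λ ()) , inj₂ (refl , λ ())
  dominating′ (2F , ↑⁴ j) = _ , _ , 23∈ , col-mate∈ j , (λ ()) , inj₁ (refl , λ ()) , inj₂ (refl , λ ())
  dominating′ (3F , ↑⁴ j) = _ , _ , 33∈ , col-mate∈ j , (λ ()) , inj₁ (refl , λ ()) , inj₂ (refl , λ ())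
  dominating′ (0F , 0F) = _ , _ , 01∈ , 02∈ , (λ ()) , inj₁ (refl , λ ()) , inj₁ (refl , λ ())
  dominating′ (0F , 1F) = _ , _ , 00∈ , 02∈ , (λ ()) , inj₁ (refl , λ ()) , inj₁ (refl , λ ())
  dominating′ (0F , 2F) = _ , _ , 00∈ , 01∈ , (λ ()) , inj₁ (refl , λ ()) , inj₁ (refl , λ ())
  dominating′ (0F , 3F) = _ , _ , 00∈ , 01∈ , (λ ()) , inj₁ (refl , λ ()) , inj₁ (refl , λ ())
  dominating′ (1F , 0F) = _ , _ , 00∈ , 13∈ , (λ ()) , inj₂ (refl , λ ()) , inj₁ (refl , λ ())
  dominating′ (1F , 1F) = _ , _ , 01∈ , 13∈ , (λ ()) , inj₂ (refl , λ ()) , inj₁ (refl , λ ())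
  dominating′ (1F , 2F) = _ , _ , 02∈ , 13∈ , (λ ()) , inj₂ (refl , λ ()) , inj₁ (refl , λ ())
  dominating′ (1F , 3F) = _ , _ , 23∈ , 33∈ , (λ ()) , inj₂ (refl , λ ()) , inj₂ (refl , λ ())
  dominating′ (2F , 0F) = _ , _ , 00∈ , 23∈ , (λ ()) , inj₂ (refl , λ ()) , inj₁ (refl , λ ())
  dominating′ (2F , 1F) = _ , _ , 01∈ , 23∈ , (λ ()) , inj₂ (refl , λ ()) , inj₁ (refl , λ ())
  dominating′ (2F , 2F) = _ , _ , 02∈ , 23∈ , (λ ()) , inj₂ (refl , λ ()) , inj₁ (refl , λ ())
  dominating′ (2F , 3F) = _ , _ , 13∈ , 33∈ , (λ ()) , inj₂ (refl , λ ()) , inj₂ (refl , λ ())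
  dominating′ (3F , 0F) = _ , _ , 00∈ , 33∈ , (λ ()) , inj₂ (refl , λ ()) , inj₁ (refl , λ ())
  dominating′ (3F , 1F) = _ , _ , 01∈ , 33∈ , (λ ()) , inj₂ (refl , λ ()) , inj₁ (refl , λ ())
  dominating′ (3F , 2F) = _ , _ , 02∈ , 33∈ , (λ ()) , inj₂ (refl , λ ()) , inj₁ (refl , λ ())
  dominating′ (3F , 3F) = _ , _ , 13∈ , 23∈ , (λ ()) , inj₂ (refl , λ ()) , inj₂ (refl , λ ())

  corner∌lift : ∀ {v} → v ∈ corner → v ∉ map lift S
  corner∌lift v∈corner v∈lifted with ∈-map⁻ lift v∈lifted
  corner∌lift (here ()) _                                                     | _ , _ , refl
  corner∌lift (there (here ())) _                                             | _ , _ , refl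
  corner∌lift (there (there (here ()))) _                                     | _ , _ , refl
  corner∌lift (there (there (there (here ())))) _                             | _ , _ , refl
  corner∌lift (there (there (there (there (here ()))))) _                     | _ , _ , refl
  corner∌lift (there (there (there (there (there (here ())))))) _             | _ , _ , refl

  unique′ : Unique S′
  unique′ = Unique.++⁺ (toWitness {a? = unique? corner} _)
                        (Unique.map⁺ lift-injective unique)
                        (λ (v∈corner , v∈lifted) → corner∌lift v∈corner v∈lifted)

  meetsRows′ : MeetsRows S′
  meetsRows′ 0F     = lose 00∈ refl
  meetsRows′ 1F     = lose 13∈ refl
  meetsRows′ 2F     = lose 23∈ refl
  meetsRows′ 3F     = lose 33∈ refl
  meetsRows′ (↑⁴ i) = lose (row-mate∈ i) refl

  meetsCols′ : MeetsCols S′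
  meetsCols′ 0F     = lose 00∈ refl
  meetsCols′ 1F     = lose 01∈ refl
  meetsCols′ 2F     = lose 02∈ refl
  meetsCols′ 3F     = lose 13∈ refl
  meetsCols′ (↑⁴ j) = lose (col-mate∈ j) refl

  small′ : 4 * length S′ ≤ 6 * (4 + n) + 6
  small′ = begin
    4 * length S′             ≡⟨ cong (λ l → 4 * (6 + l)) (length-map lift S) ⟩
    4 * (6 + length S)        ≡⟨ *-distribˡ-+ 4 6 (length S) ⟩
    24 + 4 * length S         ≤⟨ +-monoʳ-≤ 24 small ⟩
    24 + (6 * n + 6)          ≡⟨ shift n ⟩
    6 * (4 + n) + 6           ∎
    where
    open ≤-Reasoning
    shift : ∀ n → 24 + (6 * n + 6) ≡ 6 * (4 + n) + 6
    shift = solve-∀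

extend : ∀ {n} → Extendable n → Extendable (4 + n)
extend E = record
  { set        = S′
  ; unique     = unique′
  ; dominating = dominating′
  ; meetsRows  = meetsRows′
  ; meetsCols  = meetsCols′
  ; small      = small′
  }
  where open Extension E

extendable : ∀ m → Extendable (3 + m)
extendable 0                         = extendable₃
extendable 1                         = extendable₄
extendable 2                         = extendable₅
extendable 3                         = extendable₆
extendable (suc (suc (suc (suc m)))) = extend (extendable m)

upper-bound : ∀ n → 2 ≤ n → ∃[ S ] (Unique S × IsTotal2Dom (Rook n) S × 4 * length S ≤ 6 * n + 6)
upper-bound 1 (s≤s ())
upper-bound 2 _ = S₂ , toWitness {a? = unique? S₂} _ ,
  totallyDominated⇒IsTotal2Dom S₂ (toWitness {a? = totallyDominatedBy? S₂} _) , m≤m+n 16 2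
  where
  S₂ : List (Cell 2)
  S₂ = (# 0 , # 0) ∷ (# 0 , # 1) ∷ (# 1 , # 0) ∷ (# 1 , # 1) ∷ []
upper-bound (suc (suc (suc m))) _ = set , unique , dominating , small
  where open Extendable (extendable m)

γ2t≡-rook : ∀ n k d → 2 ≤ n → 3 ≤ d → d ≤ 6 → 4 * k ≡ 6 * n + d → γ2t≡ (Rook n) k
γ2t≡-rook n k d 2≤n 3≤d d≤6 4k≡ =
  γ2t≡-from-quarter-bounds (Rook n) (6 * n + 3) (6 * n + 6) k
    (≤-trans (+-monoʳ-≤ (6 * n) 3≤d) (≤-reflexive (sym 4k≡)))
    (≤-trans (≤-reflexive 4k≡) (+-monoʳ-≤ (6 * n) d≤6))
    (≤-reflexive (sym (+-assoc (6 * n) 3 3)))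
    (upper-bound n 2≤n)
    (λ S _ dom → RookLowerBound.lower-bound n S dom 2≤n)

quadruple-half : ∀ n → 4 * ((3 * n + (2 + n % 2)) / 2) ≡ 6 * n + (4 + 2 * (n % 2))
quadruple-half n = begin
  4 * ((3 * n + (2 + r)) / 2)            ≡⟨ cong (λ x → 4 * ((3 * x + (2 + r)) / 2)) n≡r+2m ⟩
  4 * ((3 * (r + m * 2) + (2 + r)) / 2)  ≡⟨ cong (λ x → 4 * (x / 2)) (halve r m) ⟩
  4 * ((2 * r + 3 * m + 1) * 2 / 2)      ≡⟨ cong (4 *_) (m*n/n≡m (2 * r + 3 * m + 1) 2) ⟩
  4 * (2 * r + 3 * m + 1)                ≡⟨ expand r m ⟩
  6 * (r + m * 2) + (4 + 2 * r)          ≡⟨ cong (λ x → 6 * x + (4 + 2 * r)) n≡r+2m ⟨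
  6 * n + (4 + 2 * r)                    ∎
  where
  open ≡-Reasoning
  r m : ℕ
  r = n % 2
  m = n / 2
  n≡r+2m : n ≡ r + m * 2
  n≡r+2m = m≡m%n+[m/n]*n n 2
  halve : ∀ r m → 3 * (r + m * 2) + (2 + r) ≡ (2 * r + 3 * m + 1) * 2
  halve = solve-∀
  expand : ∀ r m → 4 * (2 * r + 3 * m + 1) ≡ 6 * (r + m * 2) + (4 + 2 * r)
  expand = solve-∀

theorem2p15 : ∀ (n : ℕ) → 2 ≤ n →
    (n % 2 ≡ 0 → γ2t≡ (K n □ K (suc n)) ((3 * n + 2) / 2)) ×
    (n % 2 ≡ 1 → γ2t≡ (K n □ K (suc n)) ((3 * n + 3) / 2))
theorem2p15 n 2≤n =
  (λ even → γ2t≡-rook n _ 4 2≤n (n≤1+n 3) (m≤m+n 4 2) (quadruple-half-at even)) ,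
  (λ odd  → γ2t≡-rook n _ 6 2≤n (m≤m+n 3 3) ≤-refl (quadruple-half-at odd))
  where
  quadruple-half-at : ∀ {r} → n % 2 ≡ r → 4 * ((3 * n + (2 + r)) / 2) ≡ 6 * n + (4 + 2 * r)
  quadruple-half-at refl = quadruple-half n
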